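{- Let $k\geq 3$ be an integer and let $G=(\langle a\rangle\rtimes\langle b\rangle)\times\langle c\rangle\times\langle d\rangle$, where $|a|=k$, $|b|=|c|=|d|=2$ and $bab=a^{ -1}$. Let $A=\langle a\rangle$, $$S=b(A\setminus\{a^{ -1}\})\cup c(A\cup\{b\})\cup\{db,\,dcba^{ -1}\},$$ and $\Gamma=\mathrm{Cay}(G,S)$. Then $\Gamma$ has the same Deza parameters $(8k,2(k+1),2(k-1),2)$ as the $(4\times 2k)$-grid, but $\Gamma$ is not isomorphic to the $(4\times 2k)$-grid.
   Context: The Cayley graph $\mathrm{Cay}(G,S)$ has vertex set $G$ and arcs $(g,sg)$, $s\in S$, $g\in G$. A $k$-regular graph on $n$ vertices is a Deza graph with parameters $(n,k,\beta,\alpha)$ if every pair of distinct vertices has either $\alpha$ or $\beta$ common neighbours. The $(l\times m)$-grid is the line graph of the complete bipartite graph $K_{l,m}$ (equivalently, the Cartesian product $K_l\,\square\,K_m$). -}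

module Defs where

open import Data.Nat using (ℕ; zero; suc; _+_; _*_; _∸_; NonZero)
open import Data.Nat.DivMod using (_mod_)
open import Data.Fin using (Fin; toℕ) renaming (_≟_ to _≟F_)
open import Data.Bool using (Bool; true; false; _xor_) renaming (_≟_ to _≟B_)
open import Data.List using (List; []; _∷_; _++_; map; filter; length; cartesianProduct)
open import Data.List.Membership.Propositional using (_∈_)
import Data.List.Membership.DecPropositional as DecMem
open import Data.List using (allFin)
open import Data.Product using (Σ; _×_; _,_)
open import Data.Product.Properties using (≡-dec)
open import Data.Sum using (_⊎_)
open import Relation.Binary.PropositionalEquality using (_≡_; _≢_)
open import Relation.Binary.Definitions using (DecidableEquality)
open import Relation.Binary.Core using (Rel)
open import Relation.Nullary using (Dec; ¬_)
open import Relation.Nullary.Decidable using (_×-dec_; _⊎-dec_; ¬?)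
open import Function.Bundles using (_↔_; _⇔_; Inverse)

record FinGraph : Set₁ where
  field
    V      : Set
    verts  : List V                        -- enumeration of all vertices (each once)
    Adj    : V → V → Set
    adj?   : (u v : V) → Dec (Adj u v)

  degree : V → ℕ
  degree v = length (filter (adj? v) verts)

  commonNbrs : V → V → ℕ
  commonNbrs u v = length (filter (λ w → adj? u w ×-dec adj? v w) verts)

IsDeza : FinGraph → ℕ → ℕ → ℕ → ℕ → Set
IsDeza Γ n k β α =
  (length verts ≡ n)
  × (∀ v → degree v ≡ k)
  × (∀ u v → u ≢ v → (commonNbrs u v ≡ α) ⊎ (commonNbrs u v ≡ β))
  where open FinGraph Γ

Isomorphic : FinGraph → FinGraph → Set
Isomorphic Γ Δ =
  Σ (FinGraph.V Γ ↔ FinGraph.V Δ) λ φ →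
    ∀ u v → FinGraph.Adj Γ u v ⇔ FinGraph.Adj Δ (Inverse.to φ u) (Inverse.to φ v)

Grid : ℕ → ℕ → FinGraph
Grid l m = record
  { V     = Fin l × Fin m
  ; verts = cartesianProduct (allFin l) (allFin m)
  ; Adj   = λ { (i , j) (i' , j') → ((i ≡ i') × (j ≢ j')) ⊎ ((i ≢ i') × (j ≡ j')) }
  ; adj?  = λ { (i , j) (i' , j') →
               ((i ≟F i') ×-dec ¬? (j ≟F j')) ⊎-dec (¬? (i ≟F i') ×-dec (j ≟F j')) }
  }

-- The group G = (⟨a⟩ ⋊ ⟨b⟩) × ⟨c⟩ × ⟨d⟩ with |a| = k, |b|=|c|=|d| = 2,
-- bab = a⁻¹.  An element (i , e , x , y) stands for a^i b^e c^x d^y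
-- (e, x, y ∈ Bool = ℤ/2, i ∈ Fin k = ℤ/k).

module Dih (k : ℕ) .{{_ : NonZero k}} where

  G : Set
  G = Fin k × Bool × Bool × Bool

  infixl 7 _·_

  addK : Fin k → Fin k → Fin k
  addK i j = (toℕ i + toℕ j) mod k

  negK : Fin k → Fin k
  negK i = (k ∸ toℕ i) mod k

  -- b^e a^j b^e = a^{(-1)^e j}
  twist : Bool → Fin k → Fin k
  twist false j = j
  twist true  j = negK j

  -- (a^i b^e c^x d^y)(a^j b^f c^x' d^y') = a^{i + (-1)^e j} b^{e+f} c^{x+x'} d^{y+y'}
  _·_ : G → G → G
  (i , e , x , y) · (j , f , x' , y') = (addK i (twist e j) , e xor f , x xor x' , y xor y')

  ε : G
  ε = (0 mod k , false , false , false)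

  _⁻¹ : G → G
  (i , false , x , y) ⁻¹ = (negK i , false , x , y)
  (i , true  , x , y) ⁻¹ = (i , true , x , y)

  a b c d : G
  a = (1 mod k , false , false , false)
  b = (0 mod k , true  , false , false)
  c = (0 mod k , false , true  , false)
  d = (0 mod k , false , false , true)

  _^_ : G → ℕ → G
  g ^ zero  = ε
  g ^ suc n = g · (g ^ n)

  _≟G_ : DecidableEquality G
  _≟G_ = ≡-dec _≟F_ (≡-dec _≟B_ (≡-dec _≟B_ _≟B_))

  allG : List G
  allG = cartesianProduct (allFin k)
           (cartesianProduct (false ∷ true ∷ [])
             (cartesianProduct (false ∷ true ∷ []) (false ∷ true ∷ [])))

  Aset : List G
  Aset = map (λ j → a ^ toℕ j) (allFin k)

  S : List G
  S = map (b ·_) (filter (λ x → ¬? (x ≟G (a ⁻¹))) Aset)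
      ++ map (c ·_) (Aset ++ (b ∷ []))
      ++ (d · b) ∷ (d · c · b · (a ⁻¹)) ∷ []

  open DecMem _≟G_ using (_∈?_)

  Cay : FinGraph
  Cay = record
    { V     = G
    ; verts = allG
    ; Adj   = λ g h → (h · (g ⁻¹)) ∈ S
    ; adj?  = λ g h → (h · (g ⁻¹)) ∈? S
    }

module Submission where

-- Γ is a Cayley graph, so u and v have as many common neighbours as there are s ∈ S with
-- s(uv⁻¹) ∈ S. The connection set S meets each coset ⟨a⟩bᵉcˣdʸ in one of four shapes (empty,
-- the whole coset, a point, all but a point), and right multiplication by g = aⁱbᵉcˣdʸ permutes
-- these cosets while translating the exponent of a by ±i. The count thus splits into eight sizes
-- of intersections of a shape with a translated shape in ℤ/k, and evaluating them for each of the
-- seven cosets of g ≠ 1 gives 2 or 2(k − 1). The grid K₄ □ K₂ₖ is counted directly. The graphs are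
-- not isomorphic: two distinct non-adjacent vertices (i, j), (i′, j′) of a grid have only (i, j′)
-- and (i′, j) as common neighbours, whereas 1 and abc are non-adjacent in Γ with the three common
-- neighbours b, a²b and ac.

open import Defs
open import Algebra.Bundles using (AbelianGroup; Group)
open import Algebra.Core using (Op₁; Op₂)
open import Algebra.Structures using (IsAbelianGroup; IsGroup)
open import Data.Bool using (Bool; true; false; _xor_)
open import Data.Bool.Properties using (xor-assoc; xor-same; xor-identityʳ)
open import Data.Empty using (⊥; ⊥-elim)
open import Data.Fin as Fin using (Fin; toℕ; _≟_)
open import Data.Fin.Properties using (toℕ-injective; toℕ-fromℕ<; toℕ<n)
open import Data.List using (List; []; _∷_; _++_; map; filter; length; allFin; cartesianProduct)
open import Data.List.Properties using (map-cong; filter-≐; filter-++; filter-none; filter-all; length-++; length-map; length-tabulate)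
open import Data.List.Membership.Propositional using (_∈_)
open import Data.List.Membership.Propositional.Properties
  using (∈-map⁺; ∈-map⁻; ∈-allFin; ∈-filter⁺; ∈-filter⁻; ∈-++⁺ˡ; ∈-++⁺ʳ; ∈-++⁻; ∈-cartesianProduct⁺)
open import Data.List.Membership.Propositional.Properties.WithK using (unique∧set⇒bag)
open import Data.List.Relation.Binary.BagAndSetEquality using (∼bag⇒↭)
open import Data.List.Relation.Binary.Permutation.Propositional using (_↭_)
open import Data.List.Relation.Binary.Permutation.Propositional.Properties using (filter-↭; ↭-length)
open import Data.List.Relation.Unary.All as All using ([]; _∷_)
open import Data.List.Relation.Unary.Any using (here; there)
open import Data.List.Relation.Unary.Unique.Propositional using (Unique; []; _∷_)
import Data.List.Relation.Unary.Unique.Propositional.Properties as Unique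
open import Data.Nat using (ℕ; zero; suc; _+_; _*_; _∸_; _%_; _≤_; z≤n; s≤s; NonZero; >-nonZero⁻¹)
open import Data.Nat.DivMod using (_mod_; %-distribˡ-+; m%n%n≡m%n; m<n⇒m%n≡m; n%n≡0)
open import Data.Nat.ListAction using (sum)
open import Data.Nat.Properties
  using ( +-comm; +-assoc; +-suc; *-comm; *-assoc; *-identityˡ; *-identityʳ; *-distribʳ-+; *-distribˡ-∸
        ; m+n∸n≡m; m+[n∸m]≡n; <⇒≤; +-commutativeSemigroup)
open import Algebra.Properties.CommutativeSemigroup +-commutativeSemigroup using (interchange)
open import Data.Nat.Tactic.RingSolver using (solve-∀)
import Data.Product as Product
open import Data.Product using (Σ; _×_; _,_; proj₁; proj₂; swap)
open import Data.Sum using (_⊎_; inj₁; inj₂)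
open import Data.Unit using (⊤; tt)
open import Function using (_∘_; id)
open import Function.Bundles using (_⇔_; mk⇔; Equivalence; Inverse; Injection)
open import Function.Properties.Inverse using (↔⇒↣)
open import Level using (0ℓ)
open import Relation.Binary.Definitions using (DecidableEquality)
open import Relation.Binary.PropositionalEquality
  using (_≡_; _≢_; refl; sym; trans; cong; cong₂; subst; isEquivalence; module ≡-Reasoning)
open import Relation.Nullary using (Dec; yes; no; ¬_; contradiction)
open import Relation.Nullary.Decidable using (¬?; _×-dec_; _⊎-dec_)
open import Relation.Unary using (Pred; Decidable; _≐_)

indicator : {P : Set} → Dec P → ℕ
indicator (yes _) = 1
indicator (no _)  = 0

indicator-¬ : {P : Set} (P? : Dec P) → indicator (¬? P?) + indicator P? ≡ 1
indicator-¬ (yes _) = refl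
indicator-¬ (no _)  = refl

module _ {A : Set} where

  count : {P : Pred A 0ℓ} → Decidable P → List A → ℕ
  count P? xs = length (filter P? xs)

  module _ {P : Pred A 0ℓ} (P? : Decidable P) where

    count-∷ : ∀ x xs → count P? (x ∷ xs) ≡ indicator (P? x) + count P? xs
    count-∷ x xs with P? x
    ... | yes _ = refl
    ... | no _  = refl

    count-as-sum : ∀ xs → count P? xs ≡ sum (map (indicator ∘ P?) xs)
    count-as-sum []       = refl
    count-as-sum (x ∷ xs) = trans (count-∷ x xs) (cong (indicator (P? x) +_) (count-as-sum xs))

    count-++ : ∀ xs ys → count P? (xs ++ ys) ≡ count P? xs + count P? ys
    count-++ xs ys = trans (cong length (filter-++ P? xs ys)) (length-++ (filter P? xs))

    count-none : (∀ x → ¬ P x) → ∀ xs → count P? xs ≡ 0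
    count-none ¬p xs = cong length (filter-none P? (All.universal ¬p xs))

    count-all : (∀ x → P x) → ∀ xs → count P? xs ≡ length xs
    count-all p xs = cong length (filter-all P? (All.universal p xs))

    count-¬ : ∀ xs → count (¬? ∘ P?) xs + count P? xs ≡ length xs
    count-¬ []       = refl
    count-¬ (x ∷ xs) with P? x
    ... | yes _ = trans (+-suc _ _) (cong suc (count-¬ xs))
    ... | no _  = cong suc (count-¬ xs)

    count-↭ : ∀ {xs ys} → xs ↭ ys → count P? xs ≡ count P? ys
    count-↭ xs↭ys = ↭-length (filter-↭ P? xs↭ys)

  count-cong : {P Q : Pred A 0ℓ} (P? : Decidable P) (Q? : Decidable Q) → P ≐ Q →
               ∀ xs → count P? xs ≡ count Q? xs
  count-cong P? Q? P≐Q xs = cong length (filter-≐ P? Q? P≐Q xs)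

  count-⊎ : {P Q : Pred A 0ℓ} (P? : Decidable P) (Q? : Decidable Q) → (∀ x → P x → Q x → ⊥) →
            ∀ xs → count (λ x → P? x ⊎-dec Q? x) xs ≡ count P? xs + count Q? xs
  count-⊎ P? Q? disjoint []       = refl
  count-⊎ P? Q? disjoint (x ∷ xs) with P? x | Q? x
  ... | yes p | yes q = ⊥-elim (disjoint x p q)
  ... | yes _ | no _  = cong suc (count-⊎ P? Q? disjoint xs)
  ... | no _  | yes _ = trans (cong suc (count-⊎ P? Q? disjoint xs)) (sym (+-suc _ _))
  ... | no _  | no _  = count-⊎ P? Q? disjoint xs

module _ {A B : Set} where

  count-map : {P : Pred A 0ℓ} (P? : Decidable P) (f : B → A) (xs : List B) →
              count P? (map f xs) ≡ count (P? ∘ f) xs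
  count-map P? f []       = refl
  count-map P? f (x ∷ xs) with P? (f x)
  ... | yes _ = cong suc (count-map P? f xs)
  ... | no _  = count-map P? f xs

module _ {A B : Set} where

  count-cartesianProduct-× : {P : Pred A 0ℓ} {Q : Pred B 0ℓ} (P? : Decidable P) (Q? : Decidable Q) →
    ∀ xs ys → count (λ xy → P? (proj₁ xy) ×-dec Q? (proj₂ xy)) (cartesianProduct xs ys) ≡ count P? xs * count Q? ys
  count-cartesianProduct-× P? Q? []       ys = refl
  count-cartesianProduct-× {P} {Q} P? Q? (x ∷ xs) ys = begin
    count R? (map (x ,_) ys ++ cartesianProduct xs ys)
      ≡⟨ count-++ R? (map (x ,_) ys) _ ⟩
    count R? (map (x ,_) ys) + count R? (cartesianProduct xs ys)
      ≡⟨ cong₂ _+_ (count-map R? (x ,_) ys) (count-cartesianProduct-× P? Q? xs ys) ⟩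
    count (λ y → P? x ×-dec Q? y) ys + count P? xs * count Q? ys
      ≡⟨ cong (_+ _) (row (P? x)) ⟩
    indicator (P? x) * count Q? ys + count P? xs * count Q? ys
      ≡⟨ *-distribʳ-+ (count Q? ys) (indicator (P? x)) _ ⟨
    (indicator (P? x) + count P? xs) * count Q? ys
      ≡⟨ cong (_* count Q? ys) (count-∷ P? x xs) ⟨
    count P? (x ∷ xs) * count Q? ys ∎
    where
    open ≡-Reasoning
    R? : Decidable (λ (xy : A × B) → P (proj₁ xy) × Q (proj₂ xy))
    R? (x , y) = P? x ×-dec Q? y
    row : {p : Set} (p? : Dec p) → count (λ y → p? ×-dec Q? y) ys ≡ indicator p? * count Q? ys
    row (yes p) = trans (count-cong _ Q? ((λ q → proj₂ q) , (λ q → p , q)) ys) (sym (+-comm (count Q? ys) 0))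
    row (no ¬p) = count-none _ (λ _ q → ¬p (proj₁ q)) ys

  count-cartesianProduct : {R : Pred (A × B) 0ℓ} (R? : Decidable R) → ∀ xs ys →
    count R? (cartesianProduct xs ys) ≡ sum (map (λ y → count (λ x → R? (x , y)) xs) ys)
  count-cartesianProduct R? []       ys = sym (sum-map-0 ys)
    where
    sum-map-0 : ∀ ys → sum (map (λ _ → 0) ys) ≡ 0
    sum-map-0 []       = refl
    sum-map-0 (_ ∷ ys) = sum-map-0 ys
  count-cartesianProduct R? (x ∷ xs) ys = begin
    count R? (map (x ,_) ys ++ cartesianProduct xs ys)
      ≡⟨ count-++ R? (map (x ,_) ys) _ ⟩
    count R? (map (x ,_) ys) + count R? (cartesianProduct xs ys)
      ≡⟨ cong₂ _+_ (trans (count-map R? (x ,_) ys) (count-as-sum _ ys)) (count-cartesianProduct R? xs ys) ⟩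
    sum (map (λ y → indicator (R? (x , y))) ys) + sum (map (λ y → count (λ x′ → R? (x′ , y)) xs) ys)
      ≡⟨ sum-map-+ ys ⟨
    sum (map (λ y → indicator (R? (x , y)) + count (λ x′ → R? (x′ , y)) xs) ys)
      ≡⟨ cong sum (map-cong (λ y → sym (count-∷ (λ x′ → R? (x′ , y)) x xs)) ys) ⟩
    sum (map (λ y → count (λ x′ → R? (x′ , y)) (x ∷ xs)) ys) ∎
    where
    open ≡-Reasoning
    sum-map-+ : ∀ {f g : B → ℕ} zs → sum (map (λ z → f z + g z) zs) ≡ sum (map f zs) + sum (map g zs)
    sum-map-+         []       = refl
    sum-map-+ {f} {g} (z ∷ zs) = trans (cong (f z + g z +_) (sum-map-+ zs)) (interchange (f z) (g z) _ _)

+≡⇒≡∸ : ∀ {m n o} → m + n ≡ o → m ≡ o ∸ n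
+≡⇒≡∸ {m} {n} m+n≡o = trans (sym (m+n∸n≡m m n)) (cong (_∸ n) m+n≡o)

unique-complete-↭ : {A : Set} {xs ys : List A} → Unique xs → Unique ys →
                    (∀ x → x ∈ xs) → (∀ y → y ∈ ys) → xs ↭ ys
unique-complete-↭ xs! ys! ∈xs ∈ys = ∼bag⇒↭ (unique∧set⇒bag xs! ys! (mk⇔ (λ _ → ∈ys _) (λ _ → ∈xs _)))

module _ {A : Set} {xs : List A} (xs! : Unique xs) (∈xs : ∀ x → x ∈ xs) where

  count-∘-inverse : {P : Pred A 0ℓ} (P? : Decidable P) (f g : A → A) → (∀ x → f (g x) ≡ x) → (∀ x → g (f x) ≡ x) →
                    count (P? ∘ f) xs ≡ count P? xs
  count-∘-inverse P? f g fg gf = begin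
    count (P? ∘ f) xs   ≡⟨ count-map P? f xs ⟨
    count P? (map f xs) ≡⟨ count-↭ P? (unique-complete-↭ map-f! xs! ∈map-f ∈xs) ⟩
    count P? xs         ∎
    where
    open ≡-Reasoning
    map-f! : Unique (map f xs)
    map-f! = Unique.map⁺ (λ {x} {y} fx≡fy → trans (sym (gf x)) (trans (cong g fx≡fy) (gf y))) xs!
    ∈map-f : ∀ x → x ∈ map f xs
    ∈map-f x = subst (_∈ map f xs) (fg x) (∈-map⁺ f (∈xs (g x)))

  module _ (_≟_ : DecidableEquality A) where

    count-≡ : ∀ c → count (_≟ c) xs ≡ 1
    count-≡ c = go xs! (∈xs c)
      where
      go : ∀ {ys} → Unique ys → c ∈ ys → count (_≟ c) ys ≡ 1
      go (c∉ys ∷ _) (here refl) with c ≟ c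
      ... | yes _   = cong (suc ∘ length) (filter-none (_≟ c) (All.map (λ c≢y y≡c → c≢y (sym y≡c)) c∉ys))
      ... | no c≢c  = ⊥-elim (c≢c refl)
      go {y ∷ _} (c∉ys ∷ ys!) (there c∈ys) with y ≟ c
      ... | yes refl = ⊥-elim (All.lookup c∉ys c∈ys refl)
      ... | no _     = go ys! c∈ys

    count-≢ : ∀ c → count (λ x → ¬? (x ≟ c)) xs ≡ length xs ∸ 1
    count-≢ c = +≡⇒≡∸ (trans (cong (count (¬? ∘ (_≟ c)) xs +_) (sym (count-≡ c))) (count-¬ (_≟ c) xs))

    count-≢-≢ : ∀ {c c′} → c ≢ c′ → count (λ x → ¬? (x ≟ c) ×-dec ¬? (x ≟ c′)) xs ≡ length xs ∸ 2
    count-≢-≢ {c} {c′} c≢c′ = +≡⇒≡∸ (begin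
      count (λ x → ¬? (x ≟ c) ×-dec ¬? (x ≟ c′)) xs + 2
        ≡⟨ cong₂ _+_ (count-cong _ _ (neither , not-either) xs) (sym both) ⟩
      count (¬? ∘ c-or-c′?) xs + count c-or-c′? xs
        ≡⟨ count-¬ c-or-c′? xs ⟩
      length xs ∎)
      where
      open ≡-Reasoning
      c-or-c′? : Decidable (λ x → x ≡ c ⊎ x ≡ c′)
      c-or-c′? x = (x ≟ c) ⊎-dec (x ≟ c′)
      neither : ∀ {x} → ¬ x ≡ c × ¬ x ≡ c′ → ¬ (x ≡ c ⊎ x ≡ c′)
      neither (x≢c , _)  (inj₁ x≡c)  = x≢c x≡c
      neither (_ , x≢c′) (inj₂ x≡c′) = x≢c′ x≡c′
      not-either : ∀ {x} → ¬ (x ≡ c ⊎ x ≡ c′) → ¬ x ≡ c × ¬ x ≡ c′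
      not-either ¬either = ¬either ∘ inj₁ , ¬either ∘ inj₂
      both : count c-or-c′? xs ≡ 2
      both = trans (count-⊎ (_≟ c) (_≟ c′) (λ _ x≡c x≡c′ → c≢c′ (trans (sym x≡c) x≡c′)) xs)
                   (cong₂ _+_ (count-≡ c) (count-≡ c′))

    count-≡-× : ∀ c {Q : Pred A 0ℓ} (Q? : Decidable Q) → count (λ x → (x ≟ c) ×-dec Q? x) xs ≡ indicator (Q? c)
    count-≡-× c {Q} Q? with Q? c
    ... | yes q = trans (count-cong _ (_≟ c) (proj₁ , λ { refl → refl , q }) xs) (count-≡ c)
    ... | no ¬q = count-none _ (λ { _ (refl , q) → ¬q q }) xs

indicator-yes : {P : Set} (P? : Dec P) → P → indicator P? ≡ 1
indicator-yes (yes _) _ = refl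
indicator-yes (no ¬p) p = ⊥-elim (¬p p)

indicator-no : {P : Set} (P? : Dec P) → ¬ P → indicator P? ≡ 0
indicator-no (yes p) ¬p = ⊥-elim (¬p p)
indicator-no (no _)  _  = refl

indicator-≢-≡ : {A : Set} (_≟_ : DecidableEquality A) (x y : A) → indicator (¬? (x ≟ y)) + indicator (y ≟ x) ≡ 1
indicator-≢-≡ _≟_ x y with x ≟ y | y ≟ x
... | yes _   | yes _   = refl
... | no _    | no _    = refl
... | yes x≡y | no y≢x  = ⊥-elim (y≢x (sym x≡y))
... | no x≢y  | yes y≡x = ⊥-elim (x≢y (sym y≡x))

length-cartesianProduct : {A B : Set} (xs : List A) (ys : List B) →
                          length (cartesianProduct xs ys) ≡ length xs * length ys
length-cartesianProduct []       ys = refl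
length-cartesianProduct (x ∷ xs) ys = trans (length-++ (map (x ,_) ys))
  (cong₂ _+_ (length-map (x ,_) ys) (length-cartesianProduct xs ys))

module CyclicGroup (k : ℕ) .{{_ : NonZero k}} where

  open Dih k using (addK; negK)

  zeroK : Fin k
  zeroK = 0 mod k

  toℕ-mod : ∀ m → toℕ (m mod k) ≡ m % k
  toℕ-mod m = toℕ-fromℕ< _

  toℕ-addK : ∀ i j → toℕ (addK i j) ≡ (toℕ i + toℕ j) % k
  toℕ-addK i j = toℕ-mod _

  %-absorbˡ : ∀ m n → (m % k + n) % k ≡ (m + n) % k
  %-absorbˡ m n = begin
    (m % k + n) % k         ≡⟨ %-distribˡ-+ (m % k) n k ⟩
    (m % k % k + n % k) % k ≡⟨ cong (λ z → (z + n % k) % k) (m%n%n≡m%n m k) ⟩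
    (m % k + n % k) % k     ≡⟨ %-distribˡ-+ m n k ⟨
    (m + n) % k             ∎
    where open ≡-Reasoning

  %-absorbʳ : ∀ m n → (m + n % k) % k ≡ (m + n) % k
  %-absorbʳ m n = trans (cong (_% k) (+-comm m (n % k))) (trans (%-absorbˡ n m) (cong (_% k) (+-comm n m)))

  toℕ-zeroK : toℕ zeroK ≡ 0
  toℕ-zeroK = trans (toℕ-mod 0) (m<n⇒m%n≡m (>-nonZero⁻¹ k))

  toℕ-mod-toℕ : ∀ (i : Fin k) → toℕ i % k ≡ toℕ i
  toℕ-mod-toℕ i = m<n⇒m%n≡m (toℕ<n i)

  addK-comm : ∀ i j → addK i j ≡ addK j i
  addK-comm i j = toℕ-injective (begin
    toℕ (addK i j)       ≡⟨ toℕ-addK i j ⟩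
    (toℕ i + toℕ j) % k  ≡⟨ cong (_% k) (+-comm (toℕ i) (toℕ j)) ⟩
    (toℕ j + toℕ i) % k  ≡⟨ toℕ-addK j i ⟨
    toℕ (addK j i)       ∎)
    where open ≡-Reasoning

  addK-assoc : ∀ i j l → addK (addK i j) l ≡ addK i (addK j l)
  addK-assoc i j l = toℕ-injective (begin
    toℕ (addK (addK i j) l)              ≡⟨ toℕ-addK _ l ⟩
    (toℕ (addK i j) + toℕ l) % k         ≡⟨ cong (λ z → (z + toℕ l) % k) (toℕ-addK i j) ⟩
    ((toℕ i + toℕ j) % k + toℕ l) % k    ≡⟨ %-absorbˡ _ _ ⟩
    (toℕ i + toℕ j + toℕ l) % k          ≡⟨ cong (_% k) (+-assoc (toℕ i) _ _) ⟩
    (toℕ i + (toℕ j + toℕ l)) % k        ≡⟨ %-absorbʳ _ _ ⟨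
    (toℕ i + (toℕ j + toℕ l) % k) % k    ≡⟨ cong (λ z → (toℕ i + z) % k) (toℕ-addK j l) ⟨
    (toℕ i + toℕ (addK j l)) % k         ≡⟨ toℕ-addK i _ ⟨
    toℕ (addK i (addK j l))              ∎)
    where open ≡-Reasoning

  addK-identityˡ : ∀ i → addK zeroK i ≡ i
  addK-identityˡ i = toℕ-injective (begin
    toℕ (addK zeroK i)       ≡⟨ toℕ-addK zeroK i ⟩
    (toℕ zeroK + toℕ i) % k  ≡⟨ cong (λ z → (z + toℕ i) % k) toℕ-zeroK ⟩
    toℕ i % k                ≡⟨ toℕ-mod-toℕ i ⟩
    toℕ i                    ∎)
    where open ≡-Reasoning

  negK-inverseʳ : ∀ i → addK i (negK i) ≡ zeroK
  negK-inverseʳ i = toℕ-injective (begin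
    toℕ (addK i (negK i))            ≡⟨ toℕ-addK i _ ⟩
    (toℕ i + toℕ (negK i)) % k       ≡⟨ cong (λ z → (toℕ i + z) % k) (toℕ-mod (k ∸ toℕ i)) ⟩
    (toℕ i + (k ∸ toℕ i) % k) % k    ≡⟨ %-absorbʳ _ _ ⟩
    (toℕ i + (k ∸ toℕ i)) % k        ≡⟨ cong (_% k) (m+[n∸m]≡n (<⇒≤ (toℕ<n i))) ⟩
    k % k                            ≡⟨ n%n≡0 k ⟩
    0                                ≡⟨ toℕ-zeroK ⟨
    toℕ zeroK                        ∎)
    where open ≡-Reasoning

  isAbelianGroup : IsAbelianGroup _≡_ addK zeroK negK
  isAbelianGroup = record
    { isGroup = record
      { isMonoid = record
        { isSemigroup = record
          { isMagma = record { isEquivalence = isEquivalence ; ∙-cong = cong₂ addK }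
          ; assoc   = addK-assoc
          }
        ; identity = addK-identityˡ , λ i → trans (addK-comm i zeroK) (addK-identityˡ i)
        }
      ; inverse = (λ i → trans (addK-comm (negK i) i) (negK-inverseʳ i)) , negK-inverseʳ
      ; ⁻¹-cong = cong negK
      }
    ; comm = addK-comm
    }

  abelianGroup : AbelianGroup 0ℓ 0ℓ
  abelianGroup = record { isAbelianGroup = isAbelianGroup }

module Shapes (k : ℕ) .{{_ : NonZero k}} where

  open Dih k using (addK; negK)
  open CyclicGroup k
  open AbelianGroup abelianGroup using (_-_; group)
  open import Algebra.Properties.Group group using (//-rightDividesˡ; //-rightDividesʳ)

  data Shape : Set where
    empty full  : Shape
    only allBut : Fin k → Shape

  infix 4 _∈ₛ_ _∈ₛ?_

  _∈ₛ_ : Fin k → Shape → Set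
  m ∈ₛ empty    = ⊥
  m ∈ₛ full     = ⊤
  m ∈ₛ only c   = m ≡ c
  m ∈ₛ allBut c = m ≢ c

  _∈ₛ?_ : ∀ m A → Dec (m ∈ₛ A)
  m ∈ₛ? empty    = no λ ()
  m ∈ₛ? full     = yes tt
  m ∈ₛ? only c   = m ≟ c
  m ∈ₛ? allBut c = ¬? (m ≟ c)

  size : Shape → ℕ
  size empty      = 0
  size full       = k
  size (only _)   = 1
  size (allBut _) = k ∸ 1

  _⊖_ : Shape → Fin k → Shape
  empty    ⊖ t = empty
  full     ⊖ t = full
  only c   ⊖ t = only (c - t)
  allBut c ⊖ t = allBut (c - t)

  ∣_∩_∣ : Shape → Shape → ℕ
  ∣ empty    ∩ B           ∣ = 0
  ∣ full     ∩ B           ∣ = size B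
  ∣ only c   ∩ B           ∣ = indicator (c ∈ₛ? B)
  ∣ allBut c ∩ empty       ∣ = 0
  ∣ allBut c ∩ full        ∣ = k ∸ 1
  ∣ allBut c ∩ only c′     ∣ = indicator (c′ ∈ₛ? allBut c)
  ∣ allBut c ∩ allBut c′   ∣ with c ≟ c′
  ... | yes _ = k ∸ 1
  ... | no _  = k ∸ 2

  ∣allBut∩allBut∣-≢ : ∀ {c c′} → c ≢ c′ → ∣ allBut c ∩ allBut c′ ∣ ≡ k ∸ 2
  ∣allBut∩allBut∣-≢ {c} {c′} c≢c′ with c ≟ c′
  ... | yes c≡c′ = ⊥-elim (c≢c′ c≡c′)
  ... | no _     = refl

  ∈ₛ-⊖ : ∀ {m t} A → addK m t ∈ₛ A ⇔ m ∈ₛ A ⊖ t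
  ∈ₛ-⊖         empty      = mk⇔ id id
  ∈ₛ-⊖         full       = mk⇔ id id
  ∈ₛ-⊖ {m} {t} (only c)   = mk⇔ (λ m+t≡c → trans (sym (//-rightDividesʳ t m)) (cong (_- t) m+t≡c))
                                (λ m≡c-t → trans (cong (λ x → addK x t) m≡c-t) (//-rightDividesˡ t c))
  ∈ₛ-⊖ {m} {t} (allBut c) = mk⇔ (λ m+t≢c → m+t≢c ∘ Equivalence.from (∈ₛ-⊖ (only c)))
                                (λ m≢c-t → m≢c-t ∘ Equivalence.to (∈ₛ-⊖ (only c)))

  private
    elements : List (Fin k)
    elements = allFin k
    elements! : Unique elements
    elements! = Unique.allFin⁺ k
    ∈elements : ∀ m → m ∈ elements
    ∈elements = ∈-allFin
    length-elements : length elements ≡ k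
    length-elements = length-tabulate id

  count-∈ₛ : ∀ A → count (_∈ₛ? A) elements ≡ size A
  count-∈ₛ empty      = count-none (_∈ₛ? empty) (λ _ ()) elements
  count-∈ₛ full       = trans (count-all (_∈ₛ? full) (λ _ → tt) elements) length-elements
  count-∈ₛ (only c)   = count-≡ elements! ∈elements _≟_ c
  count-∈ₛ (allBut c) = trans (count-≢ elements! ∈elements _≟_ c) (cong (_∸ 1) length-elements)

  count-∩ : ∀ A B → count (λ m → m ∈ₛ? A ×-dec m ∈ₛ? B) elements ≡ ∣ A ∩ B ∣
  count-∩ empty      B           = count-none _ (λ _ ()) elements
  count-∩ full       B           = trans (count-cong _ (_∈ₛ? B) (proj₂ , (tt ,_)) elements) (count-∈ₛ B)
  count-∩ (only c)   B           = count-≡-× elements! ∈elements _≟_ c (_∈ₛ? B)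
  count-∩ (allBut c) empty       = count-none _ (λ _ ()) elements
  count-∩ (allBut c) full        = trans (count-cong _ (_∈ₛ? allBut c) (proj₁ , (_, tt)) elements) (count-∈ₛ (allBut c))
  count-∩ (allBut c) (only c′)   = trans (count-cong _ _ (swap , swap) elements)
                                         (count-≡-× elements! ∈elements _≟_ c′ (_∈ₛ? allBut c))
  count-∩ (allBut c) (allBut c′) with c ≟ c′
  ... | yes refl = trans (count-cong _ (_∈ₛ? allBut c) (proj₁ , λ m≢c → m≢c , m≢c) elements) (count-∈ₛ (allBut c))
  ... | no c≢c′  = trans (count-≢-≢ elements! ∈elements _≟_ c≢c′) (cong (_∸ 2) length-elements)

module CayleyCounting {G : Set} {_∙_ : Op₂ G} {ε : G} {_⁻¹ : Op₁ G} (isGroup : IsGroup _≡_ _∙_ ε _⁻¹)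
                      {elements : List G} (elements! : Unique elements) (∈elements : ∀ g → g ∈ elements) where

  open IsGroup isGroup using (_//_; assoc)

  private
    group : Group 0ℓ 0ℓ
    group = record { isGroup = isGroup }

  open import Algebra.Properties.Group group using (//-rightDividesˡ; //-rightDividesʳ)

  count-∙ʳ : ∀ u {P : Pred G 0ℓ} (P? : Decidable P) → count (λ w → P? (w ∙ u)) elements ≡ count P? elements
  count-∙ʳ u P? = count-∘-inverse elements! ∈elements P? (_∙ u) (_// u) (//-rightDividesˡ u) (//-rightDividesʳ u)

  module _ {S : Pred G 0ℓ} (S? : Decidable S) where

    cayley-degree : ∀ v → count (λ w → S? (w // v)) elements ≡ count S? elements
    cayley-degree v = count-∙ʳ (v ⁻¹) S?

    cayley-commonNbrs : ∀ u v → count (λ w → S? (w // u) ×-dec S? (w // v)) elements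
                                ≡ count (λ s → S? s ×-dec S? (s ∙ (u // v))) elements
    cayley-commonNbrs u v = begin
      count (λ w → S? (w // u) ×-dec S? (w // v)) elements
        ≡⟨ count-∙ʳ u (λ w → S? (w // u) ×-dec S? (w // v)) ⟨
      count (λ s → S? ((s ∙ u) // u) ×-dec S? ((s ∙ u) // v)) elements
        ≡⟨ count-cong _ _ ((λ {s} (p , q) → subst S (su//u s) p , subst S (assoc s u _) q)
                         , (λ {s} (p , q) → subst S (sym (su//u s)) p , subst S (sym (assoc s u _)) q)) elements ⟩
      count (λ s → S? s ×-dec S? (s ∙ (u // v))) elements ∎
      where
      open ≡-Reasoning
      su//u : ∀ s → (s ∙ u) // u ≡ s
      su//u = //-rightDividesʳ u

≢zero⇒2≤ : ∀ {n} .{{_ : NonZero n}} {i : Fin n} → i ≢ 0 mod n → 2 ≤ n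
≢zero⇒2≤ {suc zero}    {Fin.zero} i≢0 = ⊥-elim (i≢0 refl)
≢zero⇒2≤ {suc (suc n)}        _   = s≤s (s≤s z≤n)

n+[n∸2]≡2*[n∸1] : ∀ {n} → 2 ≤ n → n + ((n ∸ 2) + 0) ≡ 2 * (n ∸ 1)
n+[n∸2]≡2*[n∸1] (s≤s (s≤s {n = m} _)) = arith m
  where
  arith : ∀ m → 2 + m + (m + 0) ≡ 2 * (1 + m)
  arith = solve-∀

pairwise-sum≡2 : ∀ {a b c d} → a + d ≡ 1 → b + c ≡ 1 → a + (b + (c + (d + 0))) ≡ 2
pairwise-sum≡2 {a} {b} {c} {d} a+d≡1 b+c≡1 = trans (rearrange a b c d) (cong₂ _+_ a+d≡1 b+c≡1)
  where
  rearrange : ∀ a b c d → a + (b + (c + (d + 0))) ≡ (a + d) + (b + c)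
  rearrange = solve-∀

n+[n∸1+3]≡2*[n+1] : ∀ n .{{_ : NonZero n}} → n + ((n ∸ 1) + 3) ≡ 2 * (n + 1)
n+[n∸1+3]≡2*[n+1] (suc m) = arith m
  where
  arith : ∀ m → 1 + m + (m + 3) ≡ 2 * (1 + m + 1)
  arith = solve-∀

module DihedralGroup (k : ℕ) .{{_ : NonZero k}} where

  open Dih k
  open CyclicGroup k
  module ℤ = AbelianGroup abelianGroup
  open ℤ using (group; _-_)
  open import Algebra.Properties.AbelianGroup abelianGroup using (⁻¹-∙-comm)
  open import Algebra.Properties.Group group using (⁻¹-involutive; ⁻¹-injective; ε⁻¹≈ε; identityʳ-unique)

  twist-addK : ∀ e i j → twist e (addK i j) ≡ addK (twist e i) (twist e j)
  twist-addK false i j = refl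
  twist-addK true  i j = sym (⁻¹-∙-comm i j)

  twist-xor : ∀ e f j → twist (e xor f) j ≡ twist e (twist f j)
  twist-xor false f     j = refl
  twist-xor true  false j = refl
  twist-xor true  true  j = sym (⁻¹-involutive j)

  ·-assoc : ∀ g h l → (g · h) · l ≡ g · (h · l)
  ·-assoc (i , e , x , y) (j , f , x′ , y′) (l , h , x″ , y″) =
    cong₂ _,_ index (cong₂ _,_ (xor-assoc e f h) (cong₂ _,_ (xor-assoc x x′ x″) (xor-assoc y y′ y″)))
    where
    open ≡-Reasoning
    index : addK (addK i (twist e j)) (twist (e xor f) l) ≡ addK i (twist e (addK j (twist f l)))
    index = begin
      addK (addK i (twist e j)) (twist (e xor f) l)    ≡⟨ addK-assoc i _ _ ⟩
      addK i (addK (twist e j) (twist (e xor f) l))    ≡⟨ cong (λ t → addK i (addK (twist e j) t)) (twist-xor e f l) ⟩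
      addK i (addK (twist e j) (twist e (twist f l)))  ≡⟨ cong (addK i) (twist-addK e j _) ⟨
      addK i (twist e (addK j (twist f l)))            ∎

  twist-zeroK : ∀ e → twist e zeroK ≡ zeroK
  twist-zeroK false = refl
  twist-zeroK true  = ε⁻¹≈ε

  ·-identityˡ : ∀ g → ε · g ≡ g
  ·-identityˡ (i , e , x , y) = cong (_, e , x , y) (ℤ.identityˡ i)

  ·-identityʳ : ∀ g → g · ε ≡ g
  ·-identityʳ (i , e , x , y) =
    cong₂ _,_ (trans (cong (addK i) (twist-zeroK e)) (ℤ.identityʳ i))
              (cong₂ _,_ (xor-identityʳ e) (cong₂ _,_ (xor-identityʳ x) (xor-identityʳ y)))

  ·-inverseˡ : ∀ g → g ⁻¹ · g ≡ ε
  ·-inverseˡ (i , false , x , y) = cong₂ _,_ (ℤ.inverseˡ i) (cong₂ _,_ refl (cong₂ _,_ (xor-same x) (xor-same y)))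
  ·-inverseˡ (i , true  , x , y) = cong₂ _,_ (ℤ.inverseʳ i) (cong₂ _,_ refl (cong₂ _,_ (xor-same x) (xor-same y)))

  ·-inverseʳ : ∀ g → g · g ⁻¹ ≡ ε
  ·-inverseʳ (i , false , x , y) = cong₂ _,_ (ℤ.inverseʳ i) (cong₂ _,_ refl (cong₂ _,_ (xor-same x) (xor-same y)))
  ·-inverseʳ (i , true  , x , y) = cong₂ _,_ (ℤ.inverseʳ i) (cong₂ _,_ refl (cong₂ _,_ (xor-same x) (xor-same y)))

  isGroup : IsGroup _≡_ _·_ ε _⁻¹
  isGroup = record
    { isMonoid = record
      { isSemigroup = record
        { isMagma = record { isEquivalence = isEquivalence ; ∙-cong = cong₂ _·_ }
        ; assoc   = ·-assoc
        }
      ; identity = ·-identityˡ , ·-identityʳ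
      }
    ; inverse = ·-inverseˡ , ·-inverseʳ
    ; ⁻¹-cong = cong _⁻¹
    }

  dihedralGroup : Group 0ℓ 0ℓ
  dihedralGroup = record { isGroup = isGroup }

  ι : Fin k → G
  ι j = (j , false , false , false)

  one : Fin k
  one = 1 mod k

  a^-mod : ∀ n → a ^ n ≡ ι (n mod k)
  a^-mod zero    = refl
  a^-mod (suc n) = trans (cong (a ·_) (a^-mod n)) (cong ι (toℕ-injective (begin
    toℕ (addK one (n mod k))          ≡⟨ toℕ-addK one (n mod k) ⟩
    (toℕ one + toℕ (n mod k)) % k     ≡⟨ cong₂ (λ p q → (p + q) % k) (toℕ-mod 1) (toℕ-mod n) ⟩
    (1 % k + n % k) % k               ≡⟨ %-absorbˡ 1 (n % k) ⟩
    (1 + n % k) % k                   ≡⟨ %-absorbʳ 1 n ⟩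
    suc n % k                         ≡⟨ toℕ-mod (suc n) ⟨
    toℕ (suc n mod k)                 ∎)))
    where open ≡-Reasoning

  a^toℕ : ∀ j → a ^ toℕ j ≡ ι j
  a^toℕ j = trans (a^-mod (toℕ j)) (cong ι (toℕ-injective (trans (toℕ-mod (toℕ j)) (toℕ-mod-toℕ j))))

  ι∈Aset : ∀ j → ι j ∈ Aset
  ι∈Aset j = subst (_∈ Aset) (a^toℕ j) (∈-map⁺ (λ j → a ^ toℕ j) (∈-allFin j))

  ∈Aset⇒ι : ∀ {g} → g ∈ Aset → Σ (Fin k) λ j → g ≡ ι j
  ∈Aset⇒ι g∈Aset with ∈-map⁻ (λ j → a ^ toℕ j) g∈Aset
  ... | j , _ , g≡aʲ = j , trans g≡aʲ (a^toℕ j)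

  open Shapes k

  Label : Set
  Label = Bool × Bool × Bool

  -- σ (e , x , y) is the set of m with aᵐbᵉcˣdʸ ∈ S.
  σ : Label → Shape
  σ (true  , false , false) = allBut one
  σ (false , true  , false) = full
  σ (true  , true  , false) = only zeroK
  σ (true  , false , true ) = only zeroK
  σ (true  , true  , true ) = only one
  σ _                       = empty

  InS : G → Set
  InS (m , β) = m ∈ₛ σ β

  InS? : ∀ g → Dec (InS g)
  InS? (m , β) = m ∈ₛ? σ β

  bι≡ : ∀ j → b · ι j ≡ (negK j , true , false , false)
  bι≡ j = cong (_, true , false , false) (ℤ.identityˡ (negK j))

  cι≡ : ∀ j → c · ι j ≡ (j , false , true , false)
  cι≡ j = cong (_, false , true , false) (ℤ.identityˡ j)

  cb≡ : c · b ≡ (zeroK , true , true , false)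
  cb≡ = cong (_, true , true , false) (ℤ.identityˡ zeroK)

  db≡ : d · b ≡ (zeroK , true , false , true)
  db≡ = cong (_, true , false , true) (ℤ.identityˡ zeroK)

  dcba⁻¹≡ : d · c · b · a ⁻¹ ≡ (one , true , true , true)
  dcba⁻¹≡ = cong (_, true , true , true) (begin
    addK (addK (addK zeroK zeroK) zeroK) (negK (negK one))
      ≡⟨ cong (λ t → addK t (negK (negK one))) (trans (ℤ.identityʳ _) (ℤ.identityˡ zeroK)) ⟩
    addK zeroK (negK (negK one))                           ≡⟨ ℤ.identityˡ _ ⟩
    negK (negK one)                                        ≡⟨ ⁻¹-involutive one ⟩
    one                                                    ∎)
    where open ≡-Reasoning

  S-b S-c S-d : List G
  S-b = map (b ·_) (filter (λ x → ¬? (x ≟G (a ⁻¹))) Aset)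
  S-c = map (c ·_) (Aset ++ b ∷ [])
  S-d = d · b ∷ d · c · b · a ⁻¹ ∷ []

  ∈S⇒InS : ∀ {g} → g ∈ S → InS g
  ∈S⇒InS g∈S with ∈-++⁻ S-b g∈S
  ... | inj₁ g∈bA with ∈-map⁻ (b ·_) g∈bA
  ...   | h , h∈A∖a⁻¹ , refl with ∈-filter⁻ (λ x → ¬? (x ≟G (a ⁻¹))) {xs = Aset} h∈A∖a⁻¹
  ...     | h∈A , h≢a⁻¹ with ∈Aset⇒ι h∈A
  ...       | j , refl = subst InS (sym (bι≡ j))
                                   λ -j≡1 → h≢a⁻¹ (cong ι (trans (sym (⁻¹-involutive j)) (cong negK -j≡1)))
  ∈S⇒InS g∈S | inj₂ g∈rest with ∈-++⁻ S-c g∈rest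
  ... | inj₁ g∈cA with ∈-map⁻ (c ·_) g∈cA
  ...   | h , h∈A∪b , refl with ∈-++⁻ Aset h∈A∪b
  ...     | inj₁ h∈A with ∈Aset⇒ι h∈A
  ...       | j , refl = subst InS (sym (cι≡ j)) tt
  ∈S⇒InS g∈S | inj₂ _ | inj₁ _ | _ , _ , refl | inj₂ (here refl) = subst InS (sym cb≡) refl
  ∈S⇒InS g∈S | inj₂ _ | inj₂ (here refl)         = subst InS (sym db≡) refl
  ∈S⇒InS g∈S | inj₂ _ | inj₂ (there (here refl)) = subst InS (sym dcba⁻¹≡) refl

  InS⇒∈S : ∀ g → InS g → g ∈ S
  InS⇒∈S (m , true , false , false) m≢1 =
    ∈-++⁺ˡ (subst (_∈ S-b) (trans (bι≡ (negK m)) (cong (_, true , false , false) (⁻¹-involutive m)))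
      (∈-map⁺ (b ·_) (∈-filter⁺ (λ x → ¬? (x ≟G (a ⁻¹))) (ι∈Aset (negK m))
                                 (λ ι-m≡a⁻¹ → m≢1 (⁻¹-injective (cong proj₁ ι-m≡a⁻¹))))))
  InS⇒∈S (m , false , true , false) _ =
    ∈-++⁺ʳ S-b (∈-++⁺ˡ (subst (_∈ S-c) (cι≡ m) (∈-map⁺ (c ·_) (∈-++⁺ˡ (ι∈Aset m)))))
  InS⇒∈S (m , true , true , false) refl =
    ∈-++⁺ʳ S-b (∈-++⁺ˡ (subst (_∈ S-c) cb≡ (∈-map⁺ (c ·_) (∈-++⁺ʳ Aset (here refl)))))
  InS⇒∈S (m , true , false , true) refl = ∈-++⁺ʳ S-b (∈-++⁺ʳ S-c (here (sym db≡)))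
  InS⇒∈S (m , true , true , true) refl = ∈-++⁺ʳ S-b (∈-++⁺ʳ S-c (there (here (sym dcba⁻¹≡))))

  bools : List Bool
  bools = false ∷ true ∷ []

  labels : List Label
  labels = cartesianProduct bools (cartesianProduct bools bools)

  _⊕_ : Label → Label → Label
  (e , x , y) ⊕ (e′ , x′ , y′) = (e xor e′ , x xor x′ , y xor y′)

  -- (m , β) · (i , γ) = (m ± i , β ⊕ γ), so this counts the s ∈ S ∩ ⟨a⟩β with s · (i , γ) ∈ S.
  ∣σ∩σ⊕∣ : Fin k → Label → Label → ℕ
  ∣σ∩σ⊕∣ i γ β = ∣ σ β ∩ σ (β ⊕ γ) ⊖ twist (proj₁ β) i ∣

  count-InS : count InS? allG ≡ sum (map (size ∘ σ) labels)
  count-InS = trans (count-cartesianProduct InS? (allFin k) labels)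
                    (cong sum (map-cong (λ β → count-∈ₛ (σ β)) labels))

  count-InS-InS· : ∀ i γ → count (λ s → InS? s ×-dec InS? (s · (i , γ))) allG ≡ sum (map (∣σ∩σ⊕∣ i γ) labels)
  count-InS-InS· i γ = trans (count-cartesianProduct _ (allFin k) labels) (cong sum (map-cong block labels))
    where
    block : ∀ β → count (λ m → InS? (m , β) ×-dec InS? ((m , β) · (i , γ))) (allFin k) ≡ ∣σ∩σ⊕∣ i γ β
    block β@(e , _) =
      trans (count-cong _ _ (Product.map₂ (Equivalence.to (∈ₛ-⊖ _)) , Product.map₂ (Equivalence.from (∈ₛ-⊖ _))) (allFin k))
            (count-∩ (σ β) (σ (β ⊕ γ) ⊖ twist e i))

  x-i⁻¹≢x : ∀ {i} → i ≢ zeroK → ∀ x → x - negK i ≢ x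
  x-i⁻¹≢x {i} i≢0 x x-i⁻¹≡x = i≢0 (trans (sym (⁻¹-involutive i)) (identityʳ-unique x _ x-i⁻¹≡x))

  x-ε⁻¹≡x : ∀ x → x - negK zeroK ≡ x
  x-ε⁻¹≡x x = trans (cong (addK x) (⁻¹-involutive zeroK)) (ℤ.identityʳ x)

  -- The lemmas common-a, common-d, … are named after the coset of (i , γ) = aⁱbᵉcˣdʸ.
  common : Fin k → Label → ℕ
  common i γ = sum (map (∣σ∩σ⊕∣ i γ) labels)

  common-a : ∀ {i} → i ≢ zeroK → common i (false , false , false) ≡ 2 * (k ∸ 1)
  common-a {i} i≢0 = begin
    k + (∣ allBut one ∩ allBut (one - negK i) ∣ + (indicator (zeroK ≟ zeroK - negK i)
        + (indicator (zeroK ≟ zeroK - negK i) + (indicator (one ≟ one - negK i) + 0))))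
      ≡⟨ cong (k +_) (cong₂ _+_ (∣allBut∩allBut∣-≢ (x-i⁻¹≢x i≢0 one ∘ sym))
                                (cong₂ _+_ (indicator-no (zeroK ≟ _) (x-i⁻¹≢x i≢0 zeroK ∘ sym))
                                           (cong₂ _+_ (indicator-no (zeroK ≟ _) (x-i⁻¹≢x i≢0 zeroK ∘ sym))
                                                      (cong (_+ 0) (indicator-no (one ≟ _) (x-i⁻¹≢x i≢0 one ∘ sym)))))) ⟩
    k + ((k ∸ 2) + 0)
      ≡⟨ n+[n∸2]≡2*[n∸1] (≢zero⇒2≤ i≢0) ⟩
    2 * (k ∸ 1) ∎
    where open ≡-Reasoning

  common-d : ∀ i → common i (false , false , true) ≡ 2
  common-d i = pairwise-sum≡2 {indicator (¬? (zeroK - negK i ≟ one))} {indicator (¬? (zeroK ≟ one - negK i))}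
                       (indicator-≢-≡ _≟_ (zeroK - negK i) one) (indicator-¬ (zeroK ≟ one - negK i))

  common-c : ∀ i → common i (false , true , false) ≡ 2
  common-c i = pairwise-sum≡2 {indicator (¬? (zeroK - negK i ≟ one))} {indicator (zeroK ≟ one - negK i)}
                       (indicator-≢-≡ _≟_ (zeroK - negK i) one)
                       (trans (+-comm (indicator (zeroK ≟ one - negK i)) _) (indicator-¬ (zeroK ≟ one - negK i)))

  common-cd : ∀ i → common i (false , true , true) ≡ 2
  common-cd i with i ≟ zeroK
  ... | yes refl =
    cong₂ _+_ (indicator-no (¬? (one - negK zeroK ≟ one)) (contradiction (x-ε⁻¹≡x one)))
      (cong₂ _+_ fixed (cong₂ _+_ fixed
        (cong (_+ 0) (indicator-no (¬? (one ≟ one - negK zeroK)) (contradiction (sym (x-ε⁻¹≡x one)))))))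
    where
    fixed : indicator (zeroK ≟ zeroK - negK zeroK) ≡ 1
    fixed = indicator-yes (zeroK ≟ zeroK - negK zeroK) (sym (x-ε⁻¹≡x zeroK))
  ... | no i≢0 =
    cong₂ _+_ (indicator-yes (¬? (one - negK i ≟ one)) (x-i⁻¹≢x i≢0 one))
      (cong₂ _+_ unfixed (cong₂ _+_ unfixed
        (cong (_+ 0) (indicator-yes (¬? (one ≟ one - negK i)) (x-i⁻¹≢x i≢0 one ∘ sym)))))
    where
    unfixed : indicator (zeroK ≟ zeroK - negK i) ≡ 0
    unfixed = indicator-no (zeroK ≟ zeroK - negK i) (x-i⁻¹≢x i≢0 zeroK ∘ sym)

  common-b : ∀ i → common i (true , false , false) ≡ 2
  common-b i = refl

  common-bd : ∀ i → common i (true , false , true) ≡ 2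
  common-bd i = refl

  common-bc : ∀ i → common i (true , true , false) ≡ 2 * (k ∸ 1)
  common-bc i = refl

  common-bcd : ∀ i → common i (true , true , true) ≡ 2
  common-bcd i = refl

  common-value : ∀ i γ → (i , γ) ≢ ε → common i γ ≡ 2 ⊎ common i γ ≡ 2 * (k ∸ 1)
  common-value i (false , false , false) g≢ε = inj₂ (common-a (g≢ε ∘ cong ι))
  common-value i (false , false , true ) _   = inj₁ (common-d i)
  common-value i (false , true  , false) _   = inj₁ (common-c i)
  common-value i (false , true  , true ) _   = inj₁ (common-cd i)
  common-value i (true  , false , false) _   = inj₁ (common-b i)
  common-value i (true  , false , true ) _   = inj₁ (common-bd i)
  common-value i (true  , true  , false) _   = inj₂ (common-bc i)
  common-value i (true  , true  , true ) _   = inj₁ (common-bcd i)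

  allG! : Unique allG
  allG! = Unique.cartesianProduct⁺ (Unique.allFin⁺ k) (Unique.cartesianProduct⁺ bools! (Unique.cartesianProduct⁺ bools! bools!))
    where
    bools! : Unique bools
    bools! = ((λ ()) ∷ []) ∷ [] ∷ []

  ∈allG : ∀ g → g ∈ allG
  ∈allG (i , e , x , y) =
    ∈-cartesianProduct⁺ (∈-allFin i) (∈-cartesianProduct⁺ (∈bools e) (∈-cartesianProduct⁺ (∈bools x) (∈bools y)))
    where
    ∈bools : ∀ e → e ∈ bools
    ∈bools false = here refl
    ∈bools true  = there (here refl)

  open CayleyCounting isGroup allG! ∈allG
  open IsGroup isGroup using (_//_)
  open import Algebra.Properties.Group dihedralGroup using (x∙y⁻¹≈ε⇒x≈y; loop)
  open import Algebra.Properties.Loop loop using (x//ε≈x)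
  open import Data.List.Membership.DecPropositional _≟G_ using (_∈?_)
  open FinGraph Cay using (Adj; degree; commonNbrs)

  S≐InS : (_∈ S) ≐ InS
  S≐InS = ∈S⇒InS , InS⇒∈S _

  cay-degree : ∀ v → degree v ≡ 2 * (k + 1)
  cay-degree v = begin
    count (λ w → w // v ∈? S) allG  ≡⟨ cayley-degree (_∈? S) v ⟩
    count (_∈? S) allG              ≡⟨ count-cong (_∈? S) InS? S≐InS allG ⟩
    count InS? allG                 ≡⟨ count-InS ⟩
    k + ((k ∸ 1) + 3)               ≡⟨ n+[n∸1+3]≡2*[n+1] k ⟩
    2 * (k + 1)                     ∎
    where open ≡-Reasoning

  cay-commonNbrs : ∀ u v → u ≢ v → commonNbrs u v ≡ 2 ⊎ commonNbrs u v ≡ 2 * (k ∸ 1)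
  cay-commonNbrs u v u≢v = subst (λ n → n ≡ 2 ⊎ n ≡ 2 * (k ∸ 1)) (sym commonNbrs≡common)
                                 (common-value _ _ (u≢v ∘ x∙y⁻¹≈ε⇒x≈y u v))
    where
    open ≡-Reasoning
    commonNbrs≡common : commonNbrs u v ≡ common (proj₁ (u // v)) (proj₂ (u // v))
    commonNbrs≡common = begin
      count (λ w → w // u ∈? S ×-dec w // v ∈? S) allG
        ≡⟨ cayley-commonNbrs (_∈? S) u v ⟩
      count (λ s → s ∈? S ×-dec s · (u // v) ∈? S) allG
        ≡⟨ count-cong _ _ (Product.map ∈S⇒InS ∈S⇒InS , Product.map (InS⇒∈S _) (InS⇒∈S _)) allG ⟩
      count (λ s → InS? s ×-dec InS? (s · (u // v))) allG
        ≡⟨ count-InS-InS· _ _ ⟩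
      common (proj₁ (u // v)) (proj₂ (u // v)) ∎

  cay-deza : IsDeza Cay (8 * k) (2 * (k + 1)) (2 * (k ∸ 1)) 2
  cay-deza = length-allG , cay-degree , cay-commonNbrs
    where
    length-allG : length allG ≡ 8 * k
    length-allG = trans (length-cartesianProduct (allFin k) labels) (trans (cong (_* 8) (length-tabulate {n = k} id)) (*-comm k 8))

  InS⇒Adj-ε : ∀ h → InS h → Adj ε h
  InS⇒Adj-ε h = InS⇒∈S _ ∘ subst InS (sym (x//ε≈x h))

  Adj-ε⇒InS : ∀ h → Adj ε h → InS h
  Adj-ε⇒InS h = subst InS (x//ε≈x h) ∘ ∈S⇒InS

module _ {n : ℕ} where

  count-c≡ : ∀ c → count (c ≟_) (allFin n) ≡ 1
  count-c≡ c = trans (count-cong _ _ (sym , sym) (allFin n)) (count-≡ (Unique.allFin⁺ n) ∈-allFin _≟_ c)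

  count-c≢ : ∀ c → count (¬? ∘ (c ≟_)) (allFin n) ≡ n ∸ 1
  count-c≢ c = begin
    count (¬? ∘ (c ≟_)) (allFin n)        ≡⟨ count-cong _ _ ((_∘ sym) , (_∘ sym)) (allFin n) ⟩
    count (λ x → ¬? (x ≟ c)) (allFin n)   ≡⟨ count-≢ (Unique.allFin⁺ n) ∈-allFin _≟_ c ⟩
    length (allFin n) ∸ 1                 ≡⟨ cong (_∸ 1) (length-tabulate {n = n} id) ⟩
    n ∸ 1                                 ∎
    where open ≡-Reasoning

  count-c≢-c′≢ : ∀ {c c′} → c ≢ c′ → count (λ x → ¬? (c ≟ x) ×-dec ¬? (c′ ≟ x)) (allFin n) ≡ n ∸ 2
  count-c≢-c′≢ {c} {c′} c≢c′ = begin
    count (λ x → ¬? (c ≟ x) ×-dec ¬? (c′ ≟ x)) (allFin n)  ≡⟨ count-cong _ _ (flip-≢ , flip-≢) (allFin n) ⟩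
    count (λ x → ¬? (x ≟ c) ×-dec ¬? (x ≟ c′)) (allFin n)  ≡⟨ count-≢-≢ (Unique.allFin⁺ n) ∈-allFin _≟_ c≢c′ ⟩
    length (allFin n) ∸ 2                                  ≡⟨ cong (_∸ 2) (length-tabulate {n = n} id) ⟩
    n ∸ 2                                                  ∎
    where
    open ≡-Reasoning
    flip-≢ : ∀ {x y x′ y′ : Fin n} → x ≢ y × x′ ≢ y′ → y ≢ x × y′ ≢ x′
    flip-≢ = Product.map (_∘ sym) (_∘ sym)

module GridCounting (l m : ℕ) where

  open FinGraph (Grid l m)

  grid-degree : ∀ u → degree u ≡ (m ∸ 1) + (l ∸ 1)
  grid-degree (i , j) = begin
    count (adj? (i , j)) verts
      ≡⟨ count-⊎ _ _ (λ _ (i≡p , _) (i≢p , _) → i≢p i≡p) verts ⟩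
    count (λ w → (i ≟ proj₁ w) ×-dec ¬? (j ≟ proj₂ w)) verts
      + count (λ w → ¬? (i ≟ proj₁ w) ×-dec (j ≟ proj₂ w)) verts
      ≡⟨ cong₂ _+_ (count-cartesianProduct-× (i ≟_) (¬? ∘ (j ≟_)) (allFin l) (allFin m))
                   (count-cartesianProduct-× (¬? ∘ (i ≟_)) (j ≟_) (allFin l) (allFin m)) ⟩
    count (i ≟_) (allFin l) * count (¬? ∘ (j ≟_)) (allFin m) + count (¬? ∘ (i ≟_)) (allFin l) * count (j ≟_) (allFin m)
      ≡⟨ cong₂ _+_ (cong₂ _*_ (count-c≡ i) (count-c≢ j)) (cong₂ _*_ (count-c≢ i) (count-c≡ j)) ⟩
    1 * (m ∸ 1) + (l ∸ 1) * 1
      ≡⟨ cong₂ _+_ (*-identityˡ (m ∸ 1)) (*-identityʳ (l ∸ 1)) ⟩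
    (m ∸ 1) + (l ∸ 1) ∎
    where open ≡-Reasoning

  module _ {i i′ : Fin l} {j j′ : Fin m} {p : Fin l} {q : Fin m} where

    common-row : i ≡ i′ → j ≢ j′ →
                 (Adj (i , j) (p , q) × Adj (i′ , j′) (p , q)) ⇔ (i ≡ p × (j ≢ q × j′ ≢ q))
    common-row refl j≢j′ = mk⇔ to λ (i≡p , j≢q , j′≢q) → inj₁ (i≡p , j≢q) , inj₁ (i≡p , j′≢q)
      where
      to : Adj (i , j) (p , q) × Adj (i , j′) (p , q) → i ≡ p × (j ≢ q × j′ ≢ q)
      to (inj₁ (i≡p , j≢q) , inj₁ (_ , j′≢q))   = i≡p , j≢q , j′≢q
      to (inj₁ (i≡p , _)   , inj₂ (i≢p , _))    = ⊥-elim (i≢p i≡p)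
      to (inj₂ (i≢p , _)   , inj₁ (i≡p , _))    = ⊥-elim (i≢p i≡p)
      to (inj₂ (_ , j≡q)   , inj₂ (_ , j′≡q))   = ⊥-elim (j≢j′ (trans j≡q (sym j′≡q)))

    common-column : i ≢ i′ → j ≡ j′ →
                    (Adj (i , j) (p , q) × Adj (i′ , j′) (p , q)) ⇔ ((i ≢ p × i′ ≢ p) × j ≡ q)
    common-column i≢i′ refl = mk⇔ to λ ((i≢p , i′≢p) , j≡q) → inj₂ (i≢p , j≡q) , inj₂ (i′≢p , j≡q)
      where
      to : Adj (i , j) (p , q) × Adj (i′ , j) (p , q) → (i ≢ p × i′ ≢ p) × j ≡ q
      to (inj₂ (i≢p , j≡q) , inj₂ (i′≢p , _))   = (i≢p , i′≢p) , j≡q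
      to (inj₁ (_ , j≢q)   , inj₂ (_ , j≡q))    = ⊥-elim (j≢q j≡q)
      to (inj₂ (_ , j≡q)   , inj₁ (_ , j≢q))    = ⊥-elim (j≢q j≡q)
      to (inj₁ (i≡p , _)   , inj₁ (i′≡p , _))   = ⊥-elim (i≢i′ (trans i≡p (sym i′≡p)))

    common-skew : i ≢ i′ → j ≢ j′ →
                  (Adj (i , j) (p , q) × Adj (i′ , j′) (p , q)) ⇔ ((i ≡ p × j′ ≡ q) ⊎ (i′ ≡ p × j ≡ q))
    common-skew i≢i′ j≢j′ = mk⇔ to from
      where
      to : Adj (i , j) (p , q) × Adj (i′ , j′) (p , q) → (i ≡ p × j′ ≡ q) ⊎ (i′ ≡ p × j ≡ q)
      to (inj₁ (i≡p , _) , inj₂ (_ , j′≡q))  = inj₁ (i≡p , j′≡q)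
      to (inj₂ (_ , j≡q) , inj₁ (i′≡p , _))  = inj₂ (i′≡p , j≡q)
      to (inj₁ (i≡p , _) , inj₁ (i′≡p , _))  = ⊥-elim (i≢i′ (trans i≡p (sym i′≡p)))
      to (inj₂ (_ , j≡q) , inj₂ (_ , j′≡q))  = ⊥-elim (j≢j′ (trans j≡q (sym j′≡q)))
      from : (i ≡ p × j′ ≡ q) ⊎ (i′ ≡ p × j ≡ q) → Adj (i , j) (p , q) × Adj (i′ , j′) (p , q)
      from (inj₁ (i≡p , j′≡q)) = inj₁ (i≡p , λ j≡q → j≢j′ (trans j≡q (sym j′≡q)))
                               , inj₂ ((λ i′≡p → i≢i′ (trans i≡p (sym i′≡p))) , j′≡q)
      from (inj₂ (i′≡p , j≡q)) = inj₂ ((λ i≡p → i≢i′ (trans i≡p (sym i′≡p))) , j≡q)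
                               , inj₁ (i′≡p , λ j′≡q → j≢j′ (trans j≡q (sym j′≡q)))

  module _ {i i′ : Fin l} {j j′ : Fin m} where

    private
      ⇔⇒≐ : {P Q : Fin l × Fin m → Set} → (∀ {p q} → P (p , q) ⇔ Q (p , q)) → P ≐ Q
      ⇔⇒≐ P⇔Q = Equivalence.to P⇔Q , Equivalence.from P⇔Q

    commonNbrs-row : i ≡ i′ → j ≢ j′ → commonNbrs (i , j) (i′ , j′) ≡ m ∸ 2
    commonNbrs-row i≡i′ j≢j′ = begin
      commonNbrs (i , j) (i′ , j′)
        ≡⟨ count-cong _ _ (⇔⇒≐ (common-row i≡i′ j≢j′)) verts ⟩
      count (λ w → (i ≟ proj₁ w) ×-dec (¬? (j ≟ proj₂ w) ×-dec ¬? (j′ ≟ proj₂ w))) verts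
        ≡⟨ count-cartesianProduct-× (i ≟_) (λ q → ¬? (j ≟ q) ×-dec ¬? (j′ ≟ q)) (allFin l) (allFin m) ⟩
      count (i ≟_) (allFin l) * count (λ q → ¬? (j ≟ q) ×-dec ¬? (j′ ≟ q)) (allFin m)
        ≡⟨ cong₂ _*_ (count-c≡ i) (count-c≢-c′≢ j≢j′) ⟩
      1 * (m ∸ 2)
        ≡⟨ *-identityˡ (m ∸ 2) ⟩
      m ∸ 2 ∎
      where open ≡-Reasoning

    commonNbrs-column : i ≢ i′ → j ≡ j′ → commonNbrs (i , j) (i′ , j′) ≡ l ∸ 2
    commonNbrs-column i≢i′ j≡j′ = begin
      commonNbrs (i , j) (i′ , j′)
        ≡⟨ count-cong _ _ (⇔⇒≐ (common-column i≢i′ j≡j′)) verts ⟩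
      count (λ w → (¬? (i ≟ proj₁ w) ×-dec ¬? (i′ ≟ proj₁ w)) ×-dec (j ≟ proj₂ w)) verts
        ≡⟨ count-cartesianProduct-× (λ p → ¬? (i ≟ p) ×-dec ¬? (i′ ≟ p)) (j ≟_) (allFin l) (allFin m) ⟩
      count (λ p → ¬? (i ≟ p) ×-dec ¬? (i′ ≟ p)) (allFin l) * count (j ≟_) (allFin m)
        ≡⟨ cong₂ _*_ (count-c≢-c′≢ i≢i′) (count-c≡ j) ⟩
      (l ∸ 2) * 1
        ≡⟨ *-identityʳ (l ∸ 2) ⟩
      l ∸ 2 ∎
      where open ≡-Reasoning

    commonNbrs-skew : i ≢ i′ → j ≢ j′ → commonNbrs (i , j) (i′ , j′) ≡ 2
    commonNbrs-skew i≢i′ j≢j′ = begin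
      commonNbrs (i , j) (i′ , j′)
        ≡⟨ count-cong _ _ (⇔⇒≐ (common-skew i≢i′ j≢j′)) verts ⟩
      count (λ w → corner? i j′ w ⊎-dec corner? i′ j w) verts
        ≡⟨ count-⊎ (corner? i j′) (corner? i′ j) (λ _ (i≡p , _) (i′≡p , _) → i≢i′ (trans i≡p (sym i′≡p)))
                   verts ⟩
      count (corner? i j′) verts + count (corner? i′ j) verts
        ≡⟨ cong₂ _+_ (count-cartesianProduct-× (i ≟_) (j′ ≟_) (allFin l) (allFin m))
                     (count-cartesianProduct-× (i′ ≟_) (j ≟_) (allFin l) (allFin m)) ⟩
      count (i ≟_) (allFin l) * count (j′ ≟_) (allFin m) + count (i′ ≟_) (allFin l) * count (j ≟_) (allFin m)
        ≡⟨ cong₂ _+_ (cong₂ _*_ (count-c≡ i) (count-c≡ j′)) (cong₂ _*_ (count-c≡ i′) (count-c≡ j)) ⟩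
      2 ∎
      where
      open ≡-Reasoning
      corner? : ∀ x y → Decidable (λ (w : Fin l × Fin m) → x ≡ proj₁ w × y ≡ proj₂ w)
      corner? x y (p , q) = (x ≟ p) ×-dec (y ≟ q)

  grid-common-corners : ∀ {i i′ : Fin l} {j j′ : Fin m} {w} → (i , j) ≢ (i′ , j′) → ¬ Adj (i , j) (i′ , j′) →
                        Adj (i , j) w → Adj (i′ , j′) w → w ≡ (i , j′) ⊎ w ≡ (i′ , j)
  grid-common-corners {i} {i′} {j} {j′} u≢v ¬u~v u~w v~w with i ≟ i′ | j ≟ j′
  ... | yes refl | yes refl  = ⊥-elim (u≢v refl)
  ... | yes refl | no j≢j′   = ⊥-elim (¬u~v (inj₁ (refl , j≢j′)))
  ... | no i≢i′  | yes refl  = ⊥-elim (¬u~v (inj₂ (i≢i′ , refl)))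
  ... | no i≢i′  | no j≢j′   with Equivalence.to (common-skew i≢i′ j≢j′) (u~w , v~w)
  ...   | inj₁ (i≡p , j′≡q) = inj₁ (sym (cong₂ _,_ i≡p j′≡q))
  ...   | inj₂ (i′≡p , j≡q) = inj₂ (sym (cong₂ _,_ i′≡p j≡q))

grid-deza : ∀ k .{{_ : NonZero k}} → IsDeza (Grid 4 (2 * k)) (8 * k) (2 * (k + 1)) (2 * (k ∸ 1)) 2
grid-deza k = length-verts , degree≡ , commonNbrs≡
  where
  open FinGraph (Grid 4 (2 * k))
  open GridCounting 4 (2 * k)

  length-verts : length verts ≡ 8 * k
  length-verts = trans (length-cartesianProduct (allFin 4) (allFin (2 * k)))
                       (trans (cong (4 *_) (length-tabulate {n = 2 * k} id)) (sym (*-assoc 4 2 k)))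

  degree≡ : ∀ u → degree u ≡ 2 * (k + 1)
  degree≡ u = trans (grid-degree u) (arith k)
    where
    arith : ∀ k .{{_ : NonZero k}} → (2 * k ∸ 1) + 3 ≡ 2 * (k + 1)
    arith (suc k) = arith′ k
      where
      arith′ : ∀ k → (k + (1 + k + 0)) + 3 ≡ 2 * (1 + k + 1)
      arith′ = solve-∀

  commonNbrs≡ : ∀ u v → u ≢ v → commonNbrs u v ≡ 2 ⊎ commonNbrs u v ≡ 2 * (k ∸ 1)
  commonNbrs≡ (i , j) (i′ , j′) u≢v with i ≟ i′ | j ≟ j′
  ... | yes refl | yes refl  = ⊥-elim (u≢v refl)
  ... | yes i≡i′ | no j≢j′   = inj₂ (trans (commonNbrs-row i≡i′ j≢j′) (sym (*-distribˡ-∸ 2 k 1)))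
  ... | no i≢i′  | yes j≡j′  = inj₁ (commonNbrs-column i≢i′ j≡j′)
  ... | no i≢i′  | no j≢j′   = inj₁ (commonNbrs-skew i≢i′ j≢j′)

three-in-two : {A : Set} {a b x y z : A} → x ≡ a ⊎ x ≡ b → y ≡ a ⊎ y ≡ b → z ≡ a ⊎ z ≡ b →
               x ≢ y → x ≢ z → y ≢ z → ⊥
three-in-two (inj₁ x≡a) (inj₁ y≡a) _          x≢y _   _   = x≢y (trans x≡a (sym y≡a))
three-in-two (inj₂ x≡b) (inj₂ y≡b) _          x≢y _   _   = x≢y (trans x≡b (sym y≡b))
three-in-two (inj₁ x≡a) (inj₂ _)   (inj₁ z≡a) _   x≢z _   = x≢z (trans x≡a (sym z≡a))
three-in-two (inj₂ x≡b) (inj₁ _)   (inj₂ z≡b) _   x≢z _   = x≢z (trans x≡b (sym z≡b))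
three-in-two (inj₁ _)   (inj₂ y≡b) (inj₂ z≡b) _   _   y≢z = y≢z (trans y≡b (sym z≡b))
three-in-two (inj₂ _)   (inj₁ y≡a) (inj₁ z≡a) _   _   y≢z = y≢z (trans y≡a (sym z≡a))

cay≇grid : ∀ {k} .{{_ : NonZero k}} → 3 ≤ k → ∀ l m → ¬ Isomorphic (Dih.Cay k) (Grid l m)
cay≇grid {k} (s≤s (s≤s (s≤s _))) l m (φ , φ-adj) =
  three-in-two (corner w₁ (InS⇒Adj-ε w₁ λ ()) (InS⇒∈S _ tt))
               (corner w₂ (InS⇒Adj-ε w₂ λ ()) (InS⇒∈S _ tt))
               (corner w₃ (InS⇒Adj-ε w₃ tt)   (InS⇒∈S _ λ ()))
               ((λ ()) ∘ φ-injective) ((λ ()) ∘ φ-injective) ((λ ()) ∘ φ-injective)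
  where
  open Dih k
  open DihedralGroup k
  open GridCounting l m using (grid-common-corners)
  open Inverse φ using (to)

  φ-injective : ∀ {g h} → to g ≡ to h → g ≡ h
  φ-injective = Injection.injective (↔⇒↣ φ)

  -- v = abc, w₁ = b, w₂ = a²b, w₃ = ac.
  v w₁ w₂ w₃ : G
  v  = (1 mod k , true  , true  , false)
  w₁ = (0 mod k , true  , false , false)
  w₂ = (2 mod k , true  , false , false)
  w₃ = (1 mod k , false , true  , false)

  corner : ∀ w → FinGraph.Adj Cay ε w → FinGraph.Adj Cay v w →
           to w ≡ (proj₁ (to ε) , proj₂ (to v)) ⊎ to w ≡ (proj₁ (to v) , proj₂ (to ε))
  corner w ε~w v~w = grid-common-corners ((λ ()) ∘ φ-injective) ((λ ()) ∘ Adj-ε⇒InS v ∘ Equivalence.from (φ-adj ε v))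
                                         (Equivalence.to (φ-adj ε w) ε~w) (Equivalence.to (φ-adj v w) v~w)

lemma4p2 : (k : ℕ) .{{_ : NonZero k}} → 3 ≤ k →
    IsDeza (Dih.Cay k) (8 * k) (2 * (k + 1)) (2 * (k ∸ 1)) 2
    × IsDeza (Grid 4 (2 * k)) (8 * k) (2 * (k + 1)) (2 * (k ∸ 1)) 2
    × ¬ Isomorphic (Dih.Cay k) (Grid 4 (2 * k))
lemma4p2 k 3≤k = DihedralGroup.cay-deza k , grid-deza k , cay≇grid 3≤k 4 (2 * k)
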